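{- Let $n=n_1n_2$ be a square-free odd integer which is divisible by neither $7$ nor $13$, where $n_1=\prod_{i=1}^r p_i$ and $n_2=\prod_{j=1}^s q_j$ with primes $p_i\equiv1\pmod3$ and $q_j\equiv2\pmod3$. Let $S$ be a $T_n$-extremal sequence in $\mathbb{Z}_n$. Then every prime divisor $q$ of $n_1$ is coprime to at least two terms of $S$, and every prime divisor $q$ of $n_2$ is coprime to at least one term of $S$.
   Context: $\mathbb{Z}_n=\mathbb{Z}/n\mathbb{Z}$, $\mathbb{Z}_n^*$ its unit group, $T_n=\{a^3\bmod n: a\in\mathbb{Z}_n^*\}$. A sequence over $\mathbb{Z}_n$ is a finite multiset of elements of $\mathbb{Z}_n$; subsequences are sub-multisets. A sequence $x_1\cdots x_k$ is a $T_n$-weighted zero-sum sequence if there exist $a_1,\dots,a_k\in T_n$ with $\sum a_ix_i=0$ in $\mathbb{Z}_n$. $D_{T_n}(\mathbb{Z}_n)$ is the least positive integer $\ell$ such that every sequence over $\mathbb{Z}_n$ of length $\ell$ has a non-empty $T_n$-weighted zero-sum subsequence. A $T_n$-extremal sequence in $\mathbb{Z}_n$ is a sequence over $\mathbb{Z}_n$ of length $D_{T_n}(\mathbb{Z}_n)-1$ with no non-empty $T_n$-weighted zero-sum subsequence. A prime $q$ is coprime to a term $x\in\mathbb{Z}_n$ if $q$ does not divide (a representative of) $x$. -}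

module Defs where

open import Data.Nat using (ℕ; zero; suc; _+_; _*_; _^_; _%_; _<_; _≤_; _∸_; NonZero)
open import Data.Nat.Divisibility using (_∣_; _∣?_)
open import Data.Nat.Coprimality using (Coprime)
open import Data.Nat.Primality using (Prime)
open import Data.Fin using (Fin; toℕ)
open import Data.List using (List; []; length; zipWith; map; filter)
open import Data.Nat.ListAction using (sum)
open import Data.List.Relation.Unary.All using (All)
open import Data.List.Relation.Binary.Sublist.Propositional using (_⊆_)
open import Data.Product using (Σ; ∃; _×_; _,_)
open import Relation.Binary.PropositionalEquality using (_≡_; _≢_)
open import Relation.Nullary using (¬_)
open import Relation.Nullary.Decidable using (¬?)

-- Elements of ℤ_n are represented by Fin n (canonical residues 0..n-1).
-- A sequence over ℤ_n is a List (Fin n); a multiset up to order.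

InT : (n : ℕ) → .{{NonZero n}} → ℕ → Set
InT n t = ∃ λ a → a < n × Coprime a n × t ≡ (a ^ 3) % n

WeightedZeroSum : (n : ℕ) → .{{NonZero n}} → List (Fin n) → Set
WeightedZeroSum n xs =
  ∃ λ (ws : List ℕ) → length ws ≡ length xs × All (InT n) ws ×
    n ∣ sum (zipWith _*_ ws (map toℕ xs))

HasWZSSub : (n : ℕ) → .{{NonZero n}} → List (Fin n) → Set
HasWZSSub n S = ∃ λ (T : List (Fin n)) → T ⊆ S × T ≢ [] × WeightedZeroSum n T

AllLengthHave : (n : ℕ) → .{{NonZero n}} → ℕ → Set
AllLengthHave n ℓ = (S : List (Fin n)) → length S ≡ ℓ → HasWZSSub n S

IsDavenportT : (n : ℕ) → .{{NonZero n}} → ℕ → Set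
IsDavenportT n ℓ =
  1 ≤ ℓ × AllLengthHave n ℓ × ((m : ℕ) → 1 ≤ m → m < ℓ → ¬ AllLengthHave n m)

Extremal : (n : ℕ) → .{{NonZero n}} → List (Fin n) → Set
Extremal n S = ∃ λ ℓ → IsDavenportT n ℓ × length S ≡ ℓ ∸ 1 × ¬ HasWZSSub n S

SquareFree : ℕ → Set
SquareFree n = (p : ℕ) → Prime p → ¬ (p * p ∣ n)

coprimeCount : {n : ℕ} → ℕ → List (Fin n) → ℕ
coprimeCount q S = length (filter (λ x → ¬? (q ∣? toℕ x)) S)

-- Let q be a prime divisor of n and m = n / q, so that q ∤ m because n is square-free.
-- If S has no T_n-weighted zero-sum subsequence and E is a sequence of multiples of m none of
-- whose non-empty subsequences is a T_n-weighted zero-sum modulo q, then the terms of S divisible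
-- by q followed by E still have no weighted zero-sum subsequence. Hence they number fewer than
-- D_{T_n}(ℤ_n) = |S| + 1, and at least |E| terms of S are coprime to q.
-- Since T_n-weights are cubes of units modulo q, E = (m) works for every q. For q ≡ 1 (mod 3),
-- E = (m, g m) works as soon as -g is not a cube modulo q. Such g exists because cubing is not
-- injective on ℤ_q^*: the order-3 Möbius map x ↦ 1 / (1 - x) on {2, …, q - 1} has a fixed
-- point since 3 ∤ q - 2, and this fixed point is a cube root of -1 other than -1.

module Submission where

open import Defs
open import Data.Nat as ℕ using (ℕ; zero; suc; _≤_; _<_; _∸_; _^_; _%_; NonZero; z≤n; s≤s)
import Data.Nat.Properties as ℕ
open import Data.Nat.Divisibility using (_∣_; divides; ∣⇒≤)
open import Data.Nat.DivMod using ([m+kn]%n≡m%n)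
open import Data.Nat.Induction using (<-wellFounded)
open import Data.Nat.Primality using (Prime; prime⇒nonZero; prime⇒nonTrivial; prime⇒irreducible; euclidsLemma)
open import Data.Nat.Coprimality using (Coprime; coprime⇒GCD≡1)
open import Data.Nat.GCD using (module GCD; module Bézout)
open import Data.Nat.ListAction using (sum)
open import Data.Fin using (Fin; toℕ; fromℕ<; punchOut)
import Data.Fin.Properties as Fin
open import Data.Fin.Properties
  using (¬∀⟶∃¬; injective⇒≤; punchOut-injective; toℕ-injective; toℕ<n; toℕ-fromℕ<)
open import Data.List using (List; []; _∷_; _++_; length; map; zipWith; filter; take; drop; applyUpTo)
open import Data.List.Properties using (filter-all; length-applyUpTo; length-++; length-take; length-drop; ++-identityʳ)
open import Data.List.Membership.Propositional using (_∈_; find; lose)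
open import Data.List.Membership.Propositional.Properties
  using (∈-filter⁺; ∈-filter⁻; ∈-applyUpTo⁺; ∈-applyUpTo⁻)
open import Data.List.Relation.Unary.All using (All; []; _∷_)
open import Data.List.Relation.Unary.All.Properties using (all-filter; drop⁺)
open import Data.List.Relation.Unary.AllPairs using (_∷_)
open import Data.List.Relation.Unary.Any using (here; there; any?)
open import Data.List.Relation.Unary.Unique.Propositional using (Unique)
import Data.List.Relation.Unary.Unique.Propositional.Properties as Unique
open import Data.List.Relation.Binary.Sublist.Propositional using (_⊆_; []; _∷_; _∷ʳ_; ⊆-refl; ⊆-trans)
open import Data.List.Relation.Binary.Sublist.Propositional.Properties using (All-resp-⊆; take-⊆; filter-⊆)
open import Data.Empty using (⊥)
open import Data.Product using (∃; ∃₂; _×_; _,_; proj₁; proj₂)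
open import Data.Sum using (inj₁; inj₂)
open import Function using (_∘_)
open import Function.Definitions using (Injective)
open import Induction.WellFounded using (Acc; acc)
open import Relation.Binary.Definitions using (DecidableEquality)
open import Relation.Binary.PropositionalEquality
  using (_≡_; _≢_; refl; sym; trans; cong; cong₂; subst; module ≡-Reasoning)
open import Relation.Nullary using (¬_; ¬?; Dec; yes; no; contradiction)
open import Relation.Unary using (Pred; Decidable)

module _ {A : Set} (_≟_ : DecidableEquality A) where

  open import Data.Nat.Divisibility using (_∣0; ∣-refl; ∣m∣n⇒∣m+n)

  infixl 5 _∖_

  _∖_ : List A → A → List A
  xs ∖ a = filter (λ y → ¬? (a ≟ y)) xs

  ∈-∖⁺ : ∀ {x a xs} → x ∈ xs → a ≢ x → x ∈ xs ∖ a
  ∈-∖⁺ = ∈-filter⁺ (λ y → ¬? (_ ≟ y))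

  ∈-∖⁻ : ∀ {x a xs} → x ∈ xs ∖ a → x ∈ xs × a ≢ x
  ∈-∖⁻ = ∈-filter⁻ (λ y → ¬? (_ ≟ y))

  unique-∖ : ∀ {xs} a → Unique xs → Unique (xs ∖ a)
  unique-∖ a = Unique.filter⁺ (λ y → ¬? (a ≟ y))

  length-∖ : ∀ {a xs} → Unique xs → a ∈ xs → length xs ≡ suc (length (xs ∖ a))
  length-∖ {a} {x ∷ xs} (x∉xs ∷ u) a∈x∷xs with a ≟ x
  ... | yes refl = cong (suc ∘ length) (sym (filter-all (λ y → ¬? (a ≟ y)) x∉xs))
  ... | no a≢x with a∈x∷xs
  ...   | here a≡x = contradiction a≡x a≢x
  ...   | there a∈xs = cong suc (length-∖ u a∈xs)

  record FreeOrder3Action (f : A → A) (xs : List A) : Set where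
    field
      unique : Unique xs
      closed : ∀ {x} → x ∈ xs → f x ∈ xs
      cubed  : ∀ {x} → x ∈ xs → f (f (f x)) ≡ x
      moves  : ∀ {x} → x ∈ xs → f x ≢ x

  module _ {f : A → A} {xs : List A} (act : FreeOrder3Action f xs) {x : A} (x∈xs : x ∈ xs) where
    open FreeOrder3Action act

    orbitRemoved : List A
    orbitRemoved = xs ∖ x ∖ f x ∖ f (f x)

    private
      fx∈xs : f x ∈ xs
      fx∈xs = closed x∈xs

      ffx∈xs : f (f x) ∈ xs
      ffx∈xs = closed fx∈xs

      x≢ffx : x ≢ f (f x)
      x≢ffx x≡ffx = moves x∈xs (trans (cong f x≡ffx) (cubed x∈xs))

      f-injective : ∀ {y z} → y ∈ xs → z ∈ xs → f y ≡ f z → y ≡ z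
      f-injective {y} {z} y∈xs z∈xs fy≡fz =
        trans (sym (cubed y∈xs)) (trans (cong (f ∘ f) fy≡fz) (cubed z∈xs))

    length-orbitRemoved : length xs ≡ 3 ℕ.+ length orbitRemoved
    length-orbitRemoved =
      trans (length-∖ unique x∈xs)
        (cong suc (trans (length-∖ (unique-∖ x unique) (∈-∖⁺ fx∈xs (λ x≡fx → moves x∈xs (sym x≡fx))))
          (cong suc (length-∖ (unique-∖ (f x) (unique-∖ x unique))
            (∈-∖⁺ (∈-∖⁺ ffx∈xs x≢ffx) (λ fx≡ffx → moves fx∈xs (sym fx≡ffx)))))))

    orbitRemoved-action : FreeOrder3Action f orbitRemoved
    orbitRemoved-action = record
      { unique = unique-∖ (f (f x)) (unique-∖ (f x) (unique-∖ x unique))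
      ; closed = λ y∈rest → let y∈xs , x≢y , fx≢y , ffx≢y = members y∈rest in
          ∈-∖⁺ (∈-∖⁺ (∈-∖⁺ (closed y∈xs)
            (λ x≡fy → ffx≢y (trans (cong (f ∘ f) x≡fy) (cubed y∈xs))))
            (λ fx≡fy → x≢y (f-injective x∈xs y∈xs fx≡fy)))
            (λ ffx≡fy → fx≢y (f-injective fx∈xs y∈xs ffx≡fy))
      ; cubed = λ y∈rest → cubed (proj₁ (members y∈rest))
      ; moves = λ y∈rest → moves (proj₁ (members y∈rest))
      }
      where
      members : ∀ {y} → y ∈ orbitRemoved → y ∈ xs × x ≢ y × f x ≢ y × f (f x) ≢ y
      members y∈rest =
        let y∈₂ , ffx≢y = ∈-∖⁻ y∈rest
            y∈₁ , fx≢y = ∈-∖⁻ y∈₂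
            y∈xs , x≢y = ∈-∖⁻ y∈₁
        in y∈xs , x≢y , fx≢y , ffx≢y

  freeOrder3Action⇒3∣length : ∀ {f xs} → FreeOrder3Action f xs → 3 ∣ length xs
  freeOrder3Action⇒3∣length {f} {xs} = go xs (<-wellFounded (length xs))
    where
    go : ∀ xs → Acc _<_ (length xs) → FreeOrder3Action f xs → 3 ∣ length xs
    go [] _ _ = 3 ∣0
    go xs@(x ∷ _) (acc rec) act = subst (3 ∣_) (sym (length-orbitRemoved act x∈xs))
        (∣m∣n⇒∣m+n ∣-refl (go _ (rec shorter) (orbitRemoved-action act x∈xs)))
      where
      x∈xs = here refl
      shorter : length (orbitRemoved act x∈xs) < length xs
      shorter = subst (length (orbitRemoved act x∈xs) <_) (sym (length-orbitRemoved act x∈xs))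
                      (ℕ.m<n+m _ {3} (s≤s z≤n))

  order3⇒fixedPoint : ∀ {f xs} → Unique xs → (∀ {x} → x ∈ xs → f x ∈ xs) →
                      (∀ {x} → x ∈ xs → f (f (f x)) ≡ x) → ¬ 3 ∣ length xs →
                      ∃ λ x → x ∈ xs × f x ≡ x
  order3⇒fixedPoint {f} {xs} unique closed cubed 3∤length with any? (λ x → f x ≟ x) xs
  ... | yes fixed = find fixed
  ... | no noFixed = contradiction (freeOrder3Action⇒3∣length action) 3∤length
    where
    action : FreeOrder3Action f xs
    action = record { unique = unique ; closed = closed ; cubed = cubed
                    ; moves = λ x∈xs fx≡x → noFixed (lose x∈xs fx≡x) }

injective⇒¬misses : ∀ {n} {f : Fin n → Fin n} → Injective _≡_ _≡_ f → ∀ e → ¬ (∀ i → f i ≢ e)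
injective⇒¬misses {suc n} {f} f-injective e misses =
  ℕ.<-irrefl refl (injective⇒≤ punchOut∘f-injective)
  where
  punchOut∘f-injective : Injective _≡_ _≡_ (λ i → punchOut (misses i ∘ sym))
  punchOut∘f-injective = f-injective ∘ punchOut-injective (misses _ ∘ sym) (misses _ ∘ sym)

∣3⇒%3≢1 : ∀ {m} → 1 < m → m ∣ 3 → m % 3 ≢ 1
∣3⇒%3≢1 {1} (s≤s ()) _
∣3⇒%3≢1 {2} _ _ ()
∣3⇒%3≢1 {3} _ _ ()
∣3⇒%3≢1 {suc (suc (suc (suc m)))} _ m∣3 _ = contradiction (∣⇒≤ m∣3) λ { (s≤s (s≤s (s≤s ()))) }

%3≡1⇒3∤∸2 : ∀ {m} → 2 ≤ m → m % 3 ≡ 1 → ¬ 3 ∣ m ∸ 2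
%3≡1⇒3∤∸2 {m} 2≤m m%3≡1 (divides k m∸2≡k*3) = contradiction 2%3≡1 λ ()
  where
  open ≡-Reasoning
  2%3≡1 : 2 % 3 ≡ 1
  2%3≡1 = begin
    2 % 3                  ≡⟨ [m+kn]%n≡m%n 2 k 3 ⟨
    (2 ℕ.+ k ℕ.* 3) % 3    ≡⟨ cong (λ t → (2 ℕ.+ t) % 3) m∸2≡k*3 ⟨
    (2 ℕ.+ (m ∸ 2)) % 3    ≡⟨ cong (_% 3) (ℕ.m+[n∸m]≡n 2≤m) ⟩
    m % 3                  ≡⟨ m%3≡1 ⟩
    1                      ∎

module Integers where

  open import Data.Integer using (ℤ; +_; 1ℤ; _+_; _-_; _*_)
  import Data.Integer.Properties as ℤ
  open import Data.Integer.Divisibility.Signed using (∣m∣n⇒∣m+n; ∣n⇒∣m*n) renaming (_∣_ to _∣ℤ_)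
  open import Data.Integer.Tactic.RingSolver using (solve-∀)

  -- Cubes are written as products throughout since the ring solver does not unfold _^_.
  cube : ℤ → ℤ
  cube x = x * x * x

  pos-cube : ∀ a → + (a ^ 3) ≡ cube (+ a)
  pos-cube a = begin
    + (a ^ 3)                   ≡⟨ ℤ.pos-* a (a ^ 2) ⟩
    + a * + (a ^ 2)             ≡⟨ cong (+ a *_) (ℤ.pos-* a (a ^ 1)) ⟩
    + a * (+ a * + (a ^ 1))     ≡⟨ cong (λ t → + a * (+ a * t)) (ℤ.pos-* a 1) ⟩
    + a * (+ a * (+ a * 1ℤ))    ≡⟨ reassociate (+ a) ⟩
    cube (+ a)                  ∎
    where
    open ≡-Reasoning
    reassociate : ∀ x → x * (x * (x * 1ℤ)) ≡ x * x * x
    reassociate = solve-∀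

  ∣-linear₁ : ∀ {d a c} x → d ∣ℤ a → c ≡ x * a → d ∣ℤ c
  ∣-linear₁ x d∣a refl = ∣n⇒∣m*n x d∣a

  ∣-linear₂ : ∀ {d a b c} x y → d ∣ℤ a → d ∣ℤ b → c ≡ x * a + y * b → d ∣ℤ c
  ∣-linear₂ x y d∣a d∣b refl = ∣m∣n⇒∣m+n (∣n⇒∣m*n x d∣a) (∣n⇒∣m*n y d∣b)

  ∣-linear₃ : ∀ {d a b e c} x y z → d ∣ℤ a → d ∣ℤ b → d ∣ℤ e →
              c ≡ x * a + y * b + z * e → d ∣ℤ c
  ∣-linear₃ x y z d∣a d∣b d∣e refl = ∣m∣n⇒∣m+n (∣-linear₂ x y d∣a d∣b refl) (∣n⇒∣m*n z d∣e)

  ∣-cube-diff : ∀ {d} a b → d ∣ℤ a - b → d ∣ℤ cube a - cube b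
  ∣-cube-diff a b d∣a-b = ∣-linear₁ (a * a + a * b + b * b) d∣a-b (identity a b)
    where
    identity : ∀ a b → a * a * a - b * b * b ≡ (a * a + a * b + b * b) * (a - b)
    identity = solve-∀

CubeSumFree : ℕ → ℕ → Set
CubeSumFree p g = ∀ a b → ¬ p ∣ b → ¬ p ∣ a ^ 3 ℕ.+ g ℕ.* b ^ 3

module CubesModPrime {p : ℕ} (p-prime : Prime p) where

  open import Data.Integer using (ℤ; +_; 1ℤ; -_; _+_; _-_; _*_; _%ℕ_; _/ℕ_; ∣_∣)
  import Data.Integer.Properties as ℤ
  open import Data.Integer.DivMod using (a≡a%ℕn+[a/ℕn]*n; n%ℕd<d)
  open import Data.Integer.Divisibility.Signed using (∣ᵤ⇒∣; ∣⇒∣ᵤ; ∣-refl; _∣?_)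
    renaming (_∣_ to _∣ℤ_)
  open import Data.Integer.Tactic.RingSolver using (solve-∀)
  open Integers

  instance
    p-nonZero : NonZero p
    p-nonZero = prime⇒nonZero p-prime

  1<p : 1 < p
  1<p = ℕ.nonTrivial⇒n>1 p {{prime⇒nonTrivial p-prime}}

  multiple<p⇒0 : ∀ {m} → p ∣ m → m < p → m ≡ 0
  multiple<p⇒0 {zero}  _   _   = refl
  multiple<p⇒0 {suc m} p∣m m<p = contradiction (∣⇒≤ p∣m) (ℕ.<⇒≱ m<p)

  ∤-nonzero : ∀ {a} → 0 < a → a < p → ¬ + p ∣ℤ + a
  ∤-nonzero 0<a a<p p∣a = ℕ.<⇒≢ 0<a (sym (multiple<p⇒0 (∣⇒∣ᵤ p∣a) a<p))

  private
    ≡-mod-p-≤ : ∀ {a b} → a ≤ b → b < p → + p ∣ℤ + a - + b → a ≡ b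
    ≡-mod-p-≤ {a} {b} a≤b b<p p∣a-b =
      ℕ.≤-antisym a≤b (ℕ.m∸n≡0⇒m≤n (multiple<p⇒0 p∣b∸a (ℕ.≤-<-trans (ℕ.m∸n≤m b a) b<p)))
      where
      p∣b∸a : p ∣ b ∸ a
      p∣b∸a = subst (p ∣_) (trans (cong ∣_∣ (ℤ.m-n≡m⊖n a b)) (ℤ.∣⊖∣-≤ a≤b)) (∣⇒∣ᵤ p∣a-b)

  ≡-mod-p : ∀ {a b} → a < p → b < p → + p ∣ℤ + a - + b → a ≡ b
  ≡-mod-p {a} {b} a<p b<p p∣a-b with ℕ.≤-total a b
  ... | inj₁ a≤b = ≡-mod-p-≤ a≤b b<p p∣a-b
  ... | inj₂ b≤a = sym (≡-mod-p-≤ b≤a a<p (∣-linear₁ (- 1ℤ) p∣a-b (swap (+ a) (+ b))))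
    where
    swap : ∀ x y → y - x ≡ - 1ℤ * (x - y)
    swap = solve-∀

  ∣-%ℕ : ∀ x → + p ∣ℤ + (x %ℕ p) - x
  ∣-%ℕ x = ∣-linear₁ (- (x /ℕ p)) ∣-refl (begin
    + (x %ℕ p) - x                          ≡⟨ cong (λ t → + (x %ℕ p) - t) (a≡a%ℕn+[a/ℕn]*n x p) ⟩
    + (x %ℕ p) - (+ (x %ℕ p) + x /ℕ p * + p)  ≡⟨ cancel (+ (x %ℕ p)) (x /ℕ p) (+ p) ⟩
    - (x /ℕ p) * + p                        ∎)
    where
    open ≡-Reasoning
    cancel : ∀ r q d → r - (r + q * d) ≡ - q * d
    cancel = solve-∀

  pos-∸ : ∀ {m n} → n ≤ m → + (m ∸ n) ≡ + m - + n
  pos-∸ {m} {n} n≤m = sym (trans (ℤ.m-n≡m⊖n m n) (ℤ.⊖-≥ n≤m))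

  ∤⇒coprime : ∀ {u} → ¬ p ∣ u → Coprime p u
  ∤⇒coprime p∤u (d∣p , d∣u) with prime⇒irreducible p-prime d∣p
  ... | inj₁ d≡1 = d≡1
  ... | inj₂ refl = contradiction d∣u p∤u

  -- The Bézout coefficient of u: an inverse of u modulo p when p ∤ u, junk otherwise.
  inverse : ℕ → ℤ
  inverse u with Bézout.lemma p u
  ... | Bézout.result _ _ (Bézout.+- _ y _) = - + y
  ... | Bézout.result _ _ (Bézout.-+ _ y _) = + y

  inverse-spec : ∀ {u} → ¬ p ∣ u → + p ∣ℤ inverse u * + u - 1ℤ
  inverse-spec {u} p∤u with Bézout.lemma p u
  ... | Bézout.result _ gcd _ with GCD.unique gcd (coprime⇒GCD≡1 (∤⇒coprime p∤u))
  inverse-spec {u} p∤u | Bézout.result _ _ (Bézout.+- x y eq) | refl =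
    ∣-linear₁ (- + x) ∣-refl (begin
      - + y * + u - 1ℤ  ≡⟨ negate (+ y) (+ u) ⟩
      - (1ℤ + + y * + u) ≡⟨ cong -_ (toℤ eq) ⟩
      - (+ x * + p)      ≡⟨ ℤ.neg-distribˡ-* (+ x) (+ p) ⟩
      - + x * + p        ∎)
    where
    open ≡-Reasoning
    toℤ : 1 ℕ.+ y ℕ.* u ≡ x ℕ.* p → 1ℤ + + y * + u ≡ + x * + p
    toℤ eq = trans (sym (cong (λ t → 1ℤ + t) (ℤ.pos-* y u))) (trans (cong +_ eq) (ℤ.pos-* x p))
    negate : ∀ a b → - a * b - 1ℤ ≡ - (1ℤ + a * b)
    negate = solve-∀
  inverse-spec {u} p∤u | Bézout.result _ _ (Bézout.-+ x y eq) | refl =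
    ∣-linear₁ (+ x) ∣-refl (begin
      + y * + u - 1ℤ           ≡⟨ cong (_- 1ℤ) (sym (toℤ eq)) ⟩
      1ℤ + + x * + p - 1ℤ      ≡⟨ cancel (+ x * + p) ⟩
      + x * + p                ∎)
    where
    open ≡-Reasoning
    toℤ : 1 ℕ.+ x ℕ.* p ≡ y ℕ.* u → 1ℤ + + x * + p ≡ + y * + u
    toℤ eq = trans (sym (cong (λ t → 1ℤ + t) (ℤ.pos-* x p))) (trans (cong +_ eq) (ℤ.pos-* y u))
    cancel : ∀ a → 1ℤ + a - 1ℤ ≡ a
    cancel = solve-∀

  -- x ↦ y says y ≡ 1 / (1 - x) (mod p); this Möbius map has order 3.
  infix 4 _↦_
  _↦_ : ℕ → ℕ → Set
  x ↦ y = + p ∣ℤ + y * (1ℤ - + x) - 1ℤ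

  möbius : ℕ → ℕ
  möbius x = inverse (suc p ∸ x) %ℕ p

  möbius<p : ∀ x → möbius x < p
  möbius<p x = n%ℕd<d (inverse (suc p ∸ x)) p

  ↦-möbius : ∀ {x} → 2 ≤ x → x < p → x ↦ möbius x
  ↦-möbius {x} 2≤x x<p = ∣-linear₃ (1ℤ - + x) 1ℤ (- inverse u)
    (∣-%ℕ (inverse u)) (subst (λ t → + p ∣ℤ inverse u * t - 1ℤ) u≡1+p-x (inverse-spec p∤u)) ∣-refl
    (identity (+ möbius x) (inverse u) (+ x) (+ p))
    where
    u = suc p ∸ x
    u≡1+p-x : + u ≡ 1ℤ + + p - + x
    u≡1+p-x = pos-∸ (ℕ.m≤n⇒m≤1+n (ℕ.<⇒≤ x<p))
    p∤u : ¬ p ∣ u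
    p∤u p∣u = ℕ.<⇒≢ (ℕ.m<n⇒0<n∸m (ℕ.m<n⇒m<1+n x<p)) (sym (multiple<p⇒0 p∣u u<p))
      where
      u<p : u < p
      u<p = ℕ.≤-<-trans (ℕ.∸-monoʳ-≤ (suc p) 2≤x) (ℕ.∸-monoʳ-< {o = 0} (s≤s z≤n) (ℕ.<⇒≤ 1<p))
    identity : ∀ y i x p → y * (1ℤ - x) - 1ℤ
             ≡ (1ℤ - x) * (y - i) + 1ℤ * (i * (1ℤ + p - x) - 1ℤ) + - i * p
    identity = solve-∀

  ↦⇒2≤ : ∀ {x y} → 0 < x → x < p → x ↦ y → 2 ≤ y
  ↦⇒2≤ {x} {zero} _ _ x↦0 =
    contradiction (∣-linear₁ (- 1ℤ) x↦0 (identity (+ x))) (∤-nonzero (s≤s z≤n) 1<p)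
    where
    identity : ∀ x → 1ℤ ≡ - 1ℤ * (+ 0 * (1ℤ - x) - 1ℤ)
    identity = solve-∀
  ↦⇒2≤ {x} {suc zero} 0<x x<p x↦1 =
    contradiction (∣-linear₁ (- 1ℤ) x↦1 (identity (+ x))) (∤-nonzero 0<x x<p)
    where
    identity : ∀ x → x ≡ - 1ℤ * (1ℤ * (1ℤ - x) - 1ℤ)
    identity = solve-∀
  ↦⇒2≤ {y = suc (suc _)} _ _ _ = s≤s (s≤s z≤n)

  ↦-unique : ∀ {x y y′} → y < p → y′ < p → x ↦ y → x ↦ y′ → y ≡ y′
  ↦-unique {x} {y} {y′} y<p y′<p x↦y x↦y′ =
    ≡-mod-p y<p y′<p (∣-linear₂ (- + y) (+ y′) x↦y′ x↦y (identity (+ x) (+ y) (+ y′)))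
    where
    identity : ∀ x y y′ → y - y′ ≡ - y * (y′ * (1ℤ - x) - 1ℤ) + y′ * (y * (1ℤ - x) - 1ℤ)
    identity = solve-∀

  ↦-cycle : ∀ {x y z} → x ↦ y → y ↦ z → z ↦ x
  ↦-cycle {x} {y} {z} x↦y y↦z = ∣-linear₂ (+ z) (- (+ x - 1ℤ)) x↦y y↦z (identity (+ x) (+ y) (+ z))
    where
    identity : ∀ x y z → x * (1ℤ - z) - 1ℤ ≡ z * (y * (1ℤ - x) - 1ℤ) + - (x - 1ℤ) * (z * (1ℤ - y) - 1ℤ)
    identity = solve-∀

  möbius³ : ∀ {x} → 2 ≤ x → x < p → möbius (möbius (möbius x)) ≡ x
  möbius³ {x} 2≤x x<p =
    ↦-unique {z} (möbius<p z) x<p (↦-möbius 2≤z (möbius<p y)) (↦-cycle {x} {y} {z} x↦y y↦z)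
    where
    y = möbius x
    z = möbius y
    x↦y : x ↦ y
    x↦y = ↦-möbius 2≤x x<p
    2≤y : 2 ≤ y
    2≤y = ↦⇒2≤ {x} {y} (ℕ.<-trans (s≤s z≤n) 2≤x) x<p x↦y
    y↦z : y ↦ z
    y↦z = ↦-möbius 2≤y (möbius<p x)
    2≤z : 2 ≤ z
    2≤z = ↦⇒2≤ {y} {z} (ℕ.<-trans (s≤s z≤n) 2≤y) (möbius<p x) y↦z

  ↦-fixed⇒cubeRoot : ∀ {x} → x ↦ x → + p ∣ℤ cube (+ x) + 1ℤ
  ↦-fixed⇒cubeRoot {x} x↦x = ∣-linear₁ (- (+ x + 1ℤ)) x↦x (identity (+ x))
    where
    identity : ∀ x → x * x * x + 1ℤ ≡ - (x + 1ℤ) * (x * (1ℤ - x) - 1ℤ)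
    identity = solve-∀

  range : List ℕ
  range = applyUpTo (2 ℕ.+_) (p ∸ 2)

  ∈range⁻ : ∀ {y} → y ∈ range → 2 ≤ y × y < p
  ∈range⁻ y∈range with i , i<p∸2 , refl ← ∈-applyUpTo⁻ (2 ℕ.+_) y∈range =
    ℕ.m≤m+n 2 i , subst (2 ℕ.+ i <_) (ℕ.m+[n∸m]≡n 1<p) (ℕ.+-monoʳ-< 2 i<p∸2)

  ∈range⁺ : ∀ {y} → 2 ≤ y → y < p → y ∈ range
  ∈range⁺ 2≤y y<p =
    subst (_∈ range) (ℕ.m+[n∸m]≡n 2≤y) (∈-applyUpTo⁺ (2 ℕ.+_) (ℕ.∸-monoˡ-< y<p 2≤y))

  unique-range : Unique range
  unique-range = Unique.applyUpTo⁺₁ (2 ℕ.+_) (p ∸ 2) (λ i<j _ → ℕ.<⇒≢ i<j ∘ ℕ.+-cancelˡ-≡ 2 _ _)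

  ↦-fixed-1⇒∣3 : p ∸ 1 ↦ p ∸ 1 → + p ∣ℤ + 3
  ↦-fixed-1⇒∣3 h = ∣-linear₂ (- 1ℤ) (+ 3 - + p)
    (subst (λ t → + p ∣ℤ t * (1ℤ - t) - 1ℤ) (pos-∸ (ℕ.<⇒≤ 1<p)) h) ∣-refl (identity (+ p))
    where
    identity : ∀ p → + 3 ≡ - 1ℤ * ((p - 1ℤ) * (1ℤ - (p - 1ℤ)) - 1ℤ) + (+ 3 - p) * p
    identity = solve-∀

  möbius-closed : ∀ {y} → y ∈ range → möbius y ∈ range
  möbius-closed {y} y∈range =
    ∈range⁺ (↦⇒2≤ {y} {möbius y} (ℕ.<-trans (s≤s z≤n) 2≤y) y<p (↦-möbius 2≤y y<p)) (möbius<p y)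
    where
    2≤y = proj₁ (∈range⁻ y∈range)
    y<p = proj₂ (∈range⁻ y∈range)

  möbius-cubed : ∀ {y} → y ∈ range → möbius (möbius (möbius y)) ≡ y
  möbius-cubed {y} y∈range = möbius³ {y} (proj₁ (∈range⁻ y∈range)) (proj₂ (∈range⁻ y∈range))

  3∤length-range : p % 3 ≡ 1 → ¬ 3 ∣ length range
  3∤length-range p%3≡1 =
    subst (¬_ ∘ (3 ∣_)) (sym (length-applyUpTo (2 ℕ.+_) (p ∸ 2))) (%3≡1⇒3∤∸2 1<p p%3≡1)

  möbius-fixed⇒cubeRoot : p % 3 ≡ 1 → ∀ {x} → x ∈ range → möbius x ≡ x →
                          x < p × x ≢ p ∸ 1 × + p ∣ℤ cube (+ x) + 1ℤ
  möbius-fixed⇒cubeRoot p%3≡1 {x} x∈range möbius-x≡x = x<p , x≢p-1 , ↦-fixed⇒cubeRoot {x} x↦x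
    where
    x<p = proj₂ (∈range⁻ x∈range)
    x↦x : x ↦ x
    x↦x = subst (x ↦_) möbius-x≡x (↦-möbius (proj₁ (∈range⁻ x∈range)) x<p)
    x≢p-1 : x ≢ p ∸ 1
    x≢p-1 refl = ∣3⇒%3≢1 1<p (∣⇒∣ᵤ (↦-fixed-1⇒∣3 x↦x)) p%3≡1

  ∃-cubeRootOf-1 : p % 3 ≡ 1 → ∃ λ x → x < p × x ≢ p ∸ 1 × + p ∣ℤ cube (+ x) + 1ℤ
  ∃-cubeRootOf-1 p%3≡1 =
    let x , x∈range , möbius-x≡x = order3⇒fixedPoint ℕ._≟_ {möbius} unique-range
                                     möbius-closed möbius-cubed (3∤length-range p%3≡1)
    in x , möbius-fixed⇒cubeRoot p%3≡1 x∈range möbius-x≡x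

  minusOne-cubeRoot : + p ∣ℤ cube (+ (p ∸ 1)) + 1ℤ
  minusOne-cubeRoot = subst (λ t → + p ∣ℤ cube t + 1ℤ) (sym (pos-∸ (ℕ.<⇒≤ 1<p)))
    (∣-linear₁ (+ p * + p - + 3 * + p + + 3) ∣-refl (identity (+ p)))
    where
    identity : ∀ p → (p - 1ℤ) * (p - 1ℤ) * (p - 1ℤ) + 1ℤ ≡ (p * p - + 3 * p + + 3) * p
    identity = solve-∀

  ∣-sum⇒≡ : ∀ c {a b} → a < p → b < p → + p ∣ℤ c + + a → + p ∣ℤ c + + b → a ≡ b
  ∣-sum⇒≡ c {a} {b} a<p b<p p∣c+a p∣c+b =
    ≡-mod-p a<p b<p (∣-linear₂ 1ℤ (- 1ℤ) p∣c+a p∣c+b (identity c (+ a) (+ b)))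
    where
    identity : ∀ c a b → a - b ≡ 1ℤ * (c + a) + - 1ℤ * (c + b)
    identity = solve-∀

  IsMinusCube : ℕ → Set
  IsMinusCube g = ∃ λ (c : Fin p) → + p ∣ℤ cube (+ toℕ c) + + g

  isMinusCube? : ∀ g → Dec (IsMinusCube g)
  isMinusCube? g = Fin.any? (λ c → + p ∣? cube (+ toℕ c) + + g)

  -- An injective choice of roots g ↦ c with c³ ≡ -g would have to hit both cube roots of -1,
  -- but only g = 1 is sent to a cube root of -1.
  module _ (isMinusCube : ∀ (g : Fin p) → IsMinusCube (toℕ g)) where
    private
      root : Fin p → Fin p
      root g = proj₁ (isMinusCube g)

      root-spec : ∀ g → + p ∣ℤ cube (+ toℕ (root g)) + + toℕ g
      root-spec g = proj₂ (isMinusCube g)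

      root-injective : Injective _≡_ _≡_ root
      root-injective {g} {h} root-g≡root-h = toℕ-injective
        (∣-sum⇒≡ (cube (+ toℕ (root g))) (toℕ<n g) (toℕ<n h) (root-spec g)
          (subst (λ c → + p ∣ℤ cube (+ toℕ c) + + toℕ h) (sym root-g≡root-h) (root-spec h)))

      one : Fin p
      one = fromℕ< 1<p

      root-misses : ∀ c (c<p : c < p) → + p ∣ℤ cube (+ c) + 1ℤ → toℕ (root one) ≢ c →
               ∀ g → root g ≢ fromℕ< c<p
      root-misses c c<p c³+1 root-one≢c g root-g≡c = root-one≢c (begin
        toℕ (root one)    ≡⟨ cong (toℕ ∘ root) one≡g ⟩
        toℕ (root g)      ≡⟨ toℕ-root-g≡c ⟩
        c                 ∎)
        where
        open ≡-Reasoning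
        toℕ-root-g≡c : toℕ (root g) ≡ c
        toℕ-root-g≡c = trans (cong toℕ root-g≡c) (toℕ-fromℕ< c<p)
        one≡g : one ≡ g
        one≡g = toℕ-injective (trans (toℕ-fromℕ< 1<p) (∣-sum⇒≡ (cube (+ toℕ (root g))) 1<p (toℕ<n g)
          (subst (λ t → + p ∣ℤ cube (+ t) + 1ℤ) (sym toℕ-root-g≡c) c³+1) (root-spec g)))

      cubeRoot≢-1⇒⊥ : ∀ {x} → x < p → x ≢ p ∸ 1 → + p ∣ℤ cube (+ x) + 1ℤ → ⊥
      cubeRoot≢-1⇒⊥ {x} x<p x≢p-1 x³+1 with toℕ (root one) ℕ.≟ x
      ... | yes root-one≡x = injective⇒¬misses root-injective _
              (root-misses (p ∸ 1) (ℕ.∸-monoʳ-< {o = 0} (s≤s z≤n) (ℕ.<⇒≤ 1<p)) minusOne-cubeRoot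
                (λ root-one≡p-1 → x≢p-1 (trans (sym root-one≡x) root-one≡p-1)))
      ... | no root-one≢x = injective⇒¬misses root-injective _ (root-misses x x<p x³+1 root-one≢x)

    allMinusCubes⇒%3≢1 : p % 3 ≢ 1
    allMinusCubes⇒%3≢1 p%3≡1 =
      let _ , x<p , x≢p-1 , x³+1 = ∃-cubeRootOf-1 p%3≡1 in cubeRoot≢-1⇒⊥ x<p x≢p-1 x³+1

  cubeSumFree : ∀ {g} → ¬ IsMinusCube g → CubeSumFree p g
  cubeSumFree {g} ¬isMinusCube a b p∤b p∣sum =
    ¬isMinusCube (minusCubeRoot (inverse b) (inverse-spec p∤b))
    where
    sum-ℤ : + p ∣ℤ cube (+ a) + + g * cube (+ b)
    sum-ℤ = subst (+ p ∣ℤ_)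
      (trans (ℤ.pos-+ (a ^ 3) (g ℕ.* b ^ 3))
        (cong₂ _+_ (pos-cube a) (trans (ℤ.pos-* g (b ^ 3)) (cong (λ t → + g * t) (pos-cube b)))))
      (∣ᵤ⇒∣ p∣sum)
    -- c ≡ a / b is a cube root of -g
    minusCubeRoot : ∀ v → + p ∣ℤ v * + b - 1ℤ → IsMinusCube g
    minusCubeRoot v p∣vb-1 = fromℕ< c<p , subst (λ c → + p ∣ℤ cube (+ c) + + g) (sym (toℕ-fromℕ< c<p))
      (∣-linear₃ 1ℤ (cube v) (- + g * (1ℤ + v * + b + v * + b * (v * + b)))
        (∣-cube-diff (+ ((+ a * v) %ℕ p)) (+ a * v) (∣-%ℕ (+ a * v))) sum-ℤ p∣vb-1
        (identity (+ ((+ a * v) %ℕ p)) (+ a) (+ b) (+ g) v))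
      where
      c<p = n%ℕd<d (+ a * v) p
      identity : ∀ c a b g v → c * c * c + g
               ≡ 1ℤ * (c * c * c - a * v * (a * v) * (a * v)) + v * v * v * (a * a * a + g * (b * b * b))
                 + - g * (1ℤ + v * b + v * b * (v * b)) * (v * b - 1ℤ)
      identity = solve-∀

  ∃-cubeSumFree : p % 3 ≡ 1 → ∃ λ g → g < p × CubeSumFree p g
  ∃-cubeSumFree p%3≡1 =
    let g , ¬isMinusCube = ¬∀⟶∃¬ p (IsMinusCube ∘ toℕ) (isMinusCube? ∘ toℕ)
                                  (λ all → allMinusCubes⇒%3≢1 all p%3≡1)
    in toℕ g , toℕ<n g , cubeSumFree ¬isMinusCube

-- Opened only now: the modules above use the homonymous operations on ℤ.
open import Data.Nat using (_+_; _*_)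
open import Data.Nat.Divisibility
  using (_∣?_; _∣0; ∣-trans; ∣m∣n⇒∣m+n; ∣m+n∣m⇒∣n; n∣m*n; ∣m⇒∣m*n; ∣n⇒∣m*n; ∣1⇒≡1)
open import Data.Nat.DivMod using (_/_; m≡m%n+[m/n]*n)
open import Data.Nat.Tactic.RingSolver using (solve-∀)

⊆-++⁻ : ∀ {A : Set} (xs ys : List A) {U} → U ⊆ xs ++ ys →
        ∃₂ λ U₁ U₂ → U ≡ U₁ ++ U₂ × U₁ ⊆ xs × U₂ ⊆ ys
⊆-++⁻ []       ys U⊆ys = [] , _ , refl , [] , U⊆ys
⊆-++⁻ (x ∷ xs) ys (.x ∷ʳ U⊆) with U₁ , U₂ , refl , U₁⊆xs , U₂⊆ys ← ⊆-++⁻ xs ys U⊆ =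
  U₁ , U₂ , refl , x ∷ʳ U₁⊆xs , U₂⊆ys
⊆-++⁻ (x ∷ xs) ys (refl ∷ U⊆) with U₁ , U₂ , refl , U₁⊆xs , U₂⊆ys ← ⊆-++⁻ xs ys U⊆ =
  x ∷ U₁ , U₂ , refl , refl ∷ U₁⊆xs , U₂⊆ys

length-filter+length-filter¬ : ∀ {A : Set} {ℓ} {P : Pred A ℓ} (P? : Decidable P) xs →
                               length (filter P? xs) + length (filter (¬? ∘ P?) xs) ≡ length xs
length-filter+length-filter¬ P? [] = refl
length-filter+length-filter¬ P? (x ∷ xs) with P? x
... | yes _ = cong suc (length-filter+length-filter¬ P? xs)
... | no _  = trans (ℕ.+-suc _ _) (cong suc (length-filter+length-filter¬ P? xs))

module _ {n : ℕ} .{{_ : NonZero n}} where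

  weightedSum : List ℕ → List (Fin n) → ℕ
  weightedSum ws xs = sum (zipWith _*_ ws (map toℕ xs))

  WeightedZeroSumMod : ℕ → List (Fin n) → Set
  WeightedZeroSumMod q xs = ∃ λ ws → length ws ≡ length xs × All (InT n) ws × q ∣ weightedSum ws xs

  HasWZSSubMod : ℕ → List (Fin n) → Set
  HasWZSSubMod q E = ∃ λ U → U ⊆ E × U ≢ [] × WeightedZeroSumMod q U

  weightedZeroSum-singleton : ∀ {q} x → WeightedZeroSumMod q (x ∷ []) →
                              ∃ λ w → InT n w × q ∣ w * toℕ x + 0
  weightedZeroSum-singleton x (w ∷ [] , _ , w∈T ∷ [] , q∣sum) = w , w∈T , q∣sum
  weightedZeroSum-singleton x ([] , () , _)
  weightedZeroSum-singleton x (_ ∷ _ ∷ _ , () , _)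

  weightedZeroSum-pair : ∀ {q} x y → WeightedZeroSumMod q (x ∷ y ∷ []) →
                          ∃₂ λ w₁ w₂ → InT n w₁ × InT n w₂ × q ∣ w₁ * toℕ x + (w₂ * toℕ y + 0)
  weightedZeroSum-pair x y (w₁ ∷ w₂ ∷ [] , _ , w₁∈T ∷ w₂∈T ∷ [] , q∣sum) =
    w₁ , w₂ , w₁∈T , w₂∈T , q∣sum
  weightedZeroSum-pair x y ([] , () , _)
  weightedZeroSum-pair x y (_ ∷ [] , () , _)
  weightedZeroSum-pair x y (_ ∷ _ ∷ _ ∷ _ , () , _)

  weightedSum-++ : ∀ ws U₁ U₂ →
                   weightedSum ws (U₁ ++ U₂) ≡ weightedSum ws U₁ + weightedSum (drop (length U₁) ws) U₂
  weightedSum-++ []       []       U₂ = refl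
  weightedSum-++ []       (x ∷ U₁) U₂ = refl
  weightedSum-++ (w ∷ ws) []       U₂ = refl
  weightedSum-++ (w ∷ ws) (x ∷ U₁) U₂ =
    trans (cong (w * toℕ x +_) (weightedSum-++ ws U₁ U₂)) (sym (ℕ.+-assoc (w * toℕ x) _ _))

  ∣-weightedSum : ∀ {q} ws {U} → All (λ x → q ∣ toℕ x) U → q ∣ weightedSum ws U
  ∣-weightedSum {q} []       _           = q ∣0
  ∣-weightedSum {q} (w ∷ ws) []          = q ∣0
  ∣-weightedSum (w ∷ ws) (q∣x ∷ q∣U) = ∣m∣n⇒∣m+n (∣n⇒∣m*n w q∣x) (∣-weightedSum ws q∣U)

  divisibleTerms : ℕ → List (Fin n) → List (Fin n)
  divisibleTerms q = filter (λ x → q ∣? toℕ x)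

  weightedZeroSum-++⁻ʳ : ∀ {q} U₁ U₂ → q ∣ n → All (λ x → q ∣ toℕ x) U₁ →
                         WeightedZeroSum n (U₁ ++ U₂) → WeightedZeroSumMod q U₂
  weightedZeroSum-++⁻ʳ {q} U₁ U₂ q∣n q∣U₁ (ws , |ws| , ws∈T , n∣sum) =
    drop (length U₁) ws , |ws₂| , drop⁺ (length U₁) ws∈T , q∣sum₂
    where
    |ws₂| : length (drop (length U₁) ws) ≡ length U₂
    |ws₂| = trans (length-drop (length U₁) ws)
      (trans (cong (_∸ length U₁) (trans |ws| (length-++ U₁))) (ℕ.m+n∸m≡n (length U₁) (length U₂)))
    q∣sum₂ : q ∣ weightedSum (drop (length U₁) ws) U₂
    q∣sum₂ = ∣m+n∣m⇒∣n (subst (q ∣_) (weightedSum-++ ws U₁ U₂) (∣-trans q∣n n∣sum))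
                       (∣-weightedSum ws q∣U₁)

  -- A zero-sum subsequence must use E, and modulo q its part in S vanishes.
  ¬HasWZSSub-divisibleTerms++ : ∀ {q S E} → q ∣ n → ¬ HasWZSSub n S → ¬ HasWZSSubMod q E →
                                ¬ HasWZSSub n (divisibleTerms q S ++ E)
  ¬HasWZSSub-divisibleTerms++ {q} {S} {E} q∣n S-free E-free (U , U⊆ , U≢[] , wzs)
    with ⊆-++⁻ (divisibleTerms q S) E U⊆
  ... | U₁ , [] , refl , U₁⊆ , _ =
    S-free (U₁ ++ [] , subst (_⊆ S) (sym (++-identityʳ U₁)) (⊆-trans U₁⊆ (filter-⊆ _ S)) , U≢[] , wzs)
  ... | U₁ , U₂@(_ ∷ _) , refl , U₁⊆ , U₂⊆ =
    E-free (U₂ , U₂⊆ , (λ ()) , weightedZeroSum-++⁻ʳ U₁ U₂ q∣n (All-resp-⊆ U₁⊆ (all-filter _ S)) wzs)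

  zeroSumFree⇒length< : ∀ {ℓ T} → AllLengthHave n ℓ → ¬ HasWZSSub n T → length T < ℓ
  zeroSumFree⇒length< {ℓ} {T} allHave T-free = ℕ.≰⇒> λ ℓ≤|T| →
    let U , U⊆ , U≢[] , wzs = allHave (take ℓ T) (trans (length-take ℓ T) (ℕ.m≤n⇒m⊓n≡m ℓ≤|T|))
    in T-free (U , ⊆-trans U⊆ (take-⊆ ℓ T) , U≢[] , wzs)

  extremal⇒length≤coprimeCount : ∀ {q S E} → q ∣ n → Extremal n S → ¬ HasWZSSubMod q E →
                                 length E ≤ coprimeCount q S
  extremal⇒length≤coprimeCount {q} {S} {E} q∣n (ℓ , (1≤ℓ , allHave , _) , |S|≡ℓ∸1 , S-free) E-free =
    ℕ.+-cancelˡ-≤ d _ _ (ℕ.s≤s⁻¹ (begin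
      suc (d + length E)             ≡⟨ cong suc (length-++ (divisibleTerms q S)) ⟨
      suc (length (divisibleTerms q S ++ E)) ≤⟨ zeroSumFree⇒length< allHave T-free ⟩
      ℓ                              ≡⟨ ℕ.m∸n+n≡m 1≤ℓ ⟨
      ℓ ∸ 1 + 1                      ≡⟨ ℕ.+-comm (ℓ ∸ 1) 1 ⟩
      suc (ℓ ∸ 1)                    ≡⟨ cong suc |S|≡ℓ∸1 ⟨
      suc (length S)                 ≡⟨ cong suc (length-filter+length-filter¬ (λ x → q ∣? toℕ x) S) ⟨
      suc (d + coprimeCount q S)     ∎))
    where
    open ℕ.≤-Reasoning
    d = length (divisibleTerms q S)
    T-free = ¬HasWZSSub-divisibleTerms++ q∣n S-free E-free

  module _ {p : ℕ} (p-prime : Prime p) (p∣n : p ∣ n) (p²∤n : ¬ p * p ∣ n) where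

    open CubesModPrime p-prime using (1<p)

    private
      m : ℕ
      m = _∣_.quotient p∣n

      n≡m*p : n ≡ m * p
      n≡m*p = _∣_.equality p∣n

      p∤m : ¬ p ∣ m
      p∤m (divides k m≡k*p) =
        p²∤n (divides k (trans n≡m*p (trans (cong (_* p) m≡k*p) (ℕ.*-assoc k p p))))

      p≢1 : p ≢ 1
      p≢1 p≡1 = ℕ.<⇒≢ 1<p (sym p≡1)

      ∣-*-cancelˡ : ∀ {x y} → p ∣ x * y → ¬ p ∣ x → p ∣ y
      ∣-*-cancelˡ {x} {y} p∣xy p∤x with euclidsLemma x y p-prime p∣xy
      ... | inj₁ p∣x = contradiction p∣x p∤x
      ... | inj₂ p∣y = p∣y

      ∣-*-cancelʳ : ∀ {x y} → p ∣ x * y → ¬ p ∣ y → p ∣ x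
      ∣-*-cancelʳ {x} {y} p∣xy = ∣-*-cancelˡ (subst (p ∣_) (ℕ.*-comm x y) p∣xy)

      p∤1 : ¬ p ∣ 1
      p∤1 = p≢1 ∘ ∣1⇒≡1

    scaled : ∀ {c} → c < p → Fin n
    scaled {c} c<p = fromℕ< (subst (c * m <_) (trans (ℕ.*-comm p m) (sym n≡m*p))
                                  (ℕ.*-monoˡ-< m {{ℕ.>-nonZero m>0}} c<p))
      where
      m>0 : 0 < m
      m>0 = ℕ.n≢0⇒n>0 λ m≡0 → ℕ.≢-nonZero⁻¹ n (trans n≡m*p (cong (_* p) m≡0))

    toℕ-scaled : ∀ {c} (c<p : c < p) → toℕ (scaled c<p) ≡ c * m
    toℕ-scaled c<p = toℕ-fromℕ< _

    weight⇒cube : ∀ {w} → InT n w → ∃₂ λ a k → ¬ p ∣ a × a ^ 3 ≡ w + k * p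
    weight⇒cube {w} (a , _ , a-coprime , w≡a³%n) =
      a , a ^ 3 / n * m , (λ p∣a → p≢1 (a-coprime (p∣a , p∣n))) , (begin
        a ^ 3                     ≡⟨ m≡m%n+[m/n]*n (a ^ 3) n ⟩
        a ^ 3 % n + a ^ 3 / n * n ≡⟨ cong₂ _+_ (sym w≡a³%n) (cong (a ^ 3 / n *_) n≡m*p) ⟩
        w + a ^ 3 / n * (m * p)   ≡⟨ cong (w +_) (ℕ.*-assoc (a ^ 3 / n) m p) ⟨
        w + a ^ 3 / n * m * p     ∎)
      where open ≡-Reasoning

    weight-∤ : ∀ {w} → InT n w → ¬ p ∣ w
    weight-∤ w∈T p∣w with a , k , p∤a , a³≡w+kp ← weight⇒cube w∈T =
      p≢1 (∣1⇒≡1 (∣-*-cancelˡ (∣-*-cancelˡ (∣-*-cancelˡ p∣a³ p∤a) p∤a) p∤a))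
      where
      p∣a³ : p ∣ a ^ 3
      p∣a³ = subst (p ∣_) (sym a³≡w+kp) (∣m∣n⇒∣m+n p∣w (n∣m*n k))

    singleton-free : ∀ {c} (c<p : c < p) → ¬ p ∣ c → ¬ HasWZSSubMod p (scaled c<p ∷ [])
    singleton-free c<p p∤c (_ , _ ∷ʳ [] , U≢[] , _) = U≢[] refl
    singleton-free {c} c<p p∤c (_ , refl ∷ [] , _ , wzs)
      with w , w∈T , p∣sum ← weightedZeroSum-singleton (scaled c<p) wzs =
      p∤c (∣-*-cancelˡ (∣-*-cancelʳ p∣wcm p∤m) (weight-∤ w∈T))
      where
      reassociate : ∀ w c m → w * (c * m) + 0 ≡ w * c * m
      reassociate = solve-∀
      p∣wcm : p ∣ w * c * m
      p∣wcm = subst (p ∣_) (trans (cong (λ t → w * t + 0) (toℕ-scaled c<p)) (reassociate w c m)) p∣sum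

    cofactor : Fin n
    cofactor = scaled 1<p

    cofactor-free : ¬ HasWZSSubMod p (cofactor ∷ [])
    cofactor-free = singleton-free 1<p p∤1

    cubeSumFree⇒∤ : ∀ {g} → CubeSumFree p g → ¬ p ∣ g
    cubeSumFree⇒∤ {g} free p∣g = free 0 1 p∤1 (subst (p ∣_) (sym (ℕ.*-identityʳ g)) p∣g)

    -- Modulo p the three non-empty subsequences weigh a³ m, g b³ m and (a³ + g b³) m.
    pair-free : ∀ {g} (g<p : g < p) → CubeSumFree p g → ¬ HasWZSSubMod p (cofactor ∷ scaled g<p ∷ [])
    pair-free g<p free (_ , _ ∷ʳ _ ∷ʳ [] , U≢[] , _) = U≢[] refl
    pair-free g<p free (_ , _ ∷ʳ refl ∷ [] , _ , wzs) =
      singleton-free g<p (cubeSumFree⇒∤ free) (_ , ⊆-refl , (λ ()) , wzs)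
    pair-free g<p free (_ , refl ∷ _ ∷ʳ [] , _ , wzs) =
      cofactor-free (_ , ⊆-refl , (λ ()) , wzs)
    pair-free {g} g<p free (_ , refl ∷ refl ∷ [] , _ , wzs)
      with w₁ , w₂ , w₁∈T , w₂∈T , p∣sum ← weightedZeroSum-pair cofactor (scaled g<p) wzs
      with a , k₁ , _ , a³≡w₁+k₁p ← weight⇒cube w₁∈T
      with b , k₂ , p∤b , b³≡w₂+k₂p ← weight⇒cube w₂∈T =
      free a b p∤b (subst (p ∣_) (sym a³+gb³≡) (∣m∣n⇒∣m+n p∣w₁+gw₂ (n∣m*n (k₁ + g * k₂))))
      where
      factor : ∀ w₁ w₂ g m → w₁ * (1 * m) + (w₂ * (g * m) + 0) ≡ (w₁ + g * w₂) * m
      factor = solve-∀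
      p∣w₁+gw₂ : p ∣ w₁ + g * w₂
      p∣w₁+gw₂ = ∣-*-cancelʳ (subst (p ∣_)
        (trans (cong₂ (λ s t → w₁ * s + (w₂ * t + 0)) (toℕ-scaled 1<p) (toℕ-scaled g<p)) (factor w₁ w₂ g m))
        p∣sum) p∤m
      regroup : ∀ w₁ w₂ k₁ k₂ g p →
                w₁ + k₁ * p + g * (w₂ + k₂ * p) ≡ w₁ + g * w₂ + (k₁ + g * k₂) * p
      regroup = solve-∀
      a³+gb³≡ : a ^ 3 + g * b ^ 3 ≡ w₁ + g * w₂ + (k₁ + g * k₂) * p
      a³+gb³≡ = trans (cong₂ (λ s t → s + g * t) a³≡w₁+k₁p b³≡w₂+k₂p) (regroup w₁ w₂ k₁ k₂ g p)

corollary4p3 :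
  (n n₁ n₂ : ℕ) → .{{_ : NonZero n}} →
  n ≡ n₁ * n₂ → SquareFree n → ¬ (2 ∣ n) → ¬ (7 ∣ n) → ¬ (13 ∣ n) →
  ((p : ℕ) → Prime p → p ∣ n₁ → p % 3 ≡ 1) →
  ((q : ℕ) → Prime q → q ∣ n₂ → q % 3 ≡ 2) →
  (S : List (Fin n)) → Extremal n S →
  ((q : ℕ) → Prime q → q ∣ n₁ → 2 ≤ coprimeCount q S) ×
  ((q : ℕ) → Prime q → q ∣ n₂ → 1 ≤ coprimeCount q S)
corollary4p3 n n₁ n₂ n≡n₁n₂ squareFree _ _ _ n₁-primes _ S extremal = primeOf-n₁ , primeOf-n₂
  where
  primeOf-n₁ : (q : ℕ) → Prime q → q ∣ n₁ → 2 ≤ coprimeCount q S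
  primeOf-n₁ q q-prime q∣n₁ =
    let g , g<q , free = CubesModPrime.∃-cubeSumFree q-prime (n₁-primes q q-prime q∣n₁)
    in extremal⇒length≤coprimeCount q∣n extremal (pair-free q-prime q∣n (squareFree q q-prime) g<q free)
    where
    q∣n = subst (q ∣_) (sym n≡n₁n₂) (∣m⇒∣m*n n₂ q∣n₁)

  primeOf-n₂ : (q : ℕ) → Prime q → q ∣ n₂ → 1 ≤ coprimeCount q S
  primeOf-n₂ q q-prime q∣n₂ =
    extremal⇒length≤coprimeCount q∣n extremal (cofactor-free q-prime q∣n (squareFree q q-prime))
    where
    q∣n = subst (q ∣_) (sym n≡n₁n₂) (∣n⇒∣m*n n₁ q∣n₂)
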